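{- There exists a finite set ${\cal S}$ of jigsaw puzzle pieces such that a polyomino region $R$ can be tiled by copies of the pieces in ${\cal S}$ with the boundary color $0$ along $\partial R$ (i.e. validly tiled, in the sense described in the context) if and only if $R$ is a rectangle of size at least $3\times 3$.
   Context: Fix a color set $C=\{0,1,2,\ldots,c,\bar 1,\bar 2,\ldots,\bar c\}$. A jigsaw puzzle piece is a unit square each of whose four edges is assigned a color in $C$. Given a finite set ${\cal S}$ of pieces, a valid tiling of a polyomino region $R$ by copies of pieces of ${\cal S}$ places copies of pieces of ${\cal S}$ (each piece may be used any number of times, and pieces may be rotated) on the unit squares of $R$, one per unit square, so that every edge interior to $R$ is shared by two adjacent pieces whose colors on that edge are $i$ and $\bar i$ for some $i>0$, and every edge on the boundary $\partial R$ has color $0$ (so color $0$ never appears on an interior edge). -}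

module Defs where

open import Data.Nat using (ℕ; zero; suc)
open import Data.Fin using (Fin)
open import Data.Integer using (ℤ; _+_; _-_; _≤_; _<_; +_)
open import Data.Product using (_×_; _,_; Σ; ∃; ∃-syntax)
open import Data.Sum using (_⊎_)
open import Data.List using (List; [])
open import Data.List.Membership.Propositional using (_∈_; _∉_)
open import Relation.Binary.PropositionalEquality using (_≡_)
open import Relation.Nullary using (¬_)
open import Function.Bundles using (_⇔_)

data Color (c : ℕ) : Set where
  zero : Color c
  pos  : Fin c → Color c
  neg  : Fin c → Color c

data Match {c : ℕ} : Color c → Color c → Set where
  pos-neg : (i : Fin c) → Match (pos i) (neg i)
  neg-pos : (i : Fin c) → Match (neg i) (pos i)

record Piece (c : ℕ) : Set where
  constructor piece
  field
    north east south west : Color c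
open Piece public

rot : {c : ℕ} → Piece c → Piece c
rot (piece n e s w) = piece w n e s

rot^ : {c : ℕ} → ℕ → Piece c → Piece c
rot^ zero p = p
rot^ (suc k) p = rot (rot^ k p)

-- Unit squares of the plane, indexed by their lower-left corner.
Cell : Set
Cell = ℤ × ℤ

-- A finite set of cells, given as a list (membership = set membership).
Region : Set
Region = List Cell

northOf eastOf southOf westOf : Cell → Cell
northOf (x , y) = (x , y + + 1)
eastOf  (x , y) = (x + + 1 , y)
southOf (x , y) = (x , y - + 1)
westOf  (x , y) = (x - + 1 , y)

Adjacent : Cell → Cell → Set
Adjacent p q = (q ≡ northOf p) ⊎ (q ≡ eastOf p) ⊎ (q ≡ southOf p) ⊎ (q ≡ westOf p)

data Reach (R : Region) : Cell → Cell → Set where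
  here : ∀ {p} → p ∈ R → Reach R p p
  step : ∀ {p q r} → p ∈ R → Adjacent p q → Reach R q r → Reach R p r

IsPolyomino : Region → Set
IsPolyomino R = (∃[ p ] p ∈ R) × (∀ {p q} → p ∈ R → q ∈ R → Reach R p q)

-- The condition on a single edge of a cell p ∈ R, where a is the colour of
-- p's edge facing neighbour q, and b the colour of q's edge facing p:
-- if q ∈ R the colours must match, if q ∉ R (boundary edge) a must be 0.
EdgeOK : {c : ℕ} → Region → Cell → Color c → Color c → Set
EdgeOK R q a b = (q ∈ R → Match a b) × (q ∉ R → a ≡ zero)

ValidTiling : {c : ℕ} → List (Piece c) → Region → (Cell → Piece c) → Set
ValidTiling S R t =
  ∀ {p} → p ∈ R →
    (∃[ k ] ∃[ s ] (s ∈ S × t p ≡ rot^ k s))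
    × EdgeOK R (northOf p) (north (t p)) (south (t (northOf p)))
    × EdgeOK R (eastOf p)  (east  (t p)) (west  (t (eastOf p)))
    × EdgeOK R (southOf p) (south (t p)) (north (t (southOf p)))
    × EdgeOK R (westOf p)  (west  (t p)) (east  (t (westOf p)))

Tileable : {c : ℕ} → List (Piece c) → Region → Set
Tileable S R = ∃[ t ] ValidTiling S R t

IsRectangle≥3×3 : Region → Set
IsRectangle≥3×3 R =
  ∃[ x₀ ] ∃[ y₀ ] ∃[ a ] ∃[ b ]
    (+ 3 ≤ a) × (+ 3 ≤ b) ×
    (∀ {x y} → ((x , y) ∈ R) ⇔ ((x₀ ≤ x × x < x₀ + a) × (y₀ ≤ y × y < y₀ + b)))

module Submission where

open import Defs
import Data.Nat as ℕ
open import Data.Fin using (Fin; zero; suc)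
open import Data.Bool using (Bool; true; false; not; _∧_; if_then_else_)
import Data.Bool.Properties as Bool
open import Data.Integer using (ℤ; +_; _+_; _-_; -_; _≤_; _<_; ∣_∣; _≟_)
open import Data.Integer.Properties
open import Data.Integer.Tactic.RingSolver using (solve-∀)
open import Data.Product using (_×_; _,_; proj₁; proj₂; ∃; ∃-syntax)
open import Data.Product.Properties using (≡-dec)
open import Data.Sum using (_⊎_; inj₁; inj₂; [_,_]′)
open import Data.List using (List; _∷_; _++_; map; filter; cartesianProduct; allFin)
import Data.List.Relation.Unary.All as All
open import Data.List.Relation.Unary.Any using (here; there)
open import Data.List.Membership.Propositional using (_∈_; _∉_)
open import Data.List.Membership.Propositional.Properties
  using (∈-map⁺; ∈-++⁺ˡ; ∈-++⁺ʳ; ∈-allFin; ∈-cartesianProduct⁺; ∈-filter⁺; ∈-filter⁻)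
open import Data.List.Membership.DecPropositional (≡-dec _≟_ _≟_) using (_∈?_)
open import Data.List.Extrema ≤-totalOrder
  using (argmin; argmax; argmin-all; argmax-all; f[argmin]≤f[xs]; f[xs]≤f[argmax])
open import Relation.Nullary using (¬_; Dec; yes; no)
open import Relation.Nullary.Decidable
  using (_×-dec_; map′; does; decidable-stable; toSum; dec-true; dec-false)
open import Relation.Binary.PropositionalEquality
  using (_≡_; _≢_; refl; sym; trans; cong; cong₂; subst; subst₂)
open import Function using (id; _∘_)
open import Function.Bundles using (_⇔_; mk⇔; Equivalence)

-- Let every non-0 colour carry a code saying which of the other sides of its piece have colour 0,
-- and take all pieces whose codes are correct.  Matching colours carry the same code, so two pieces
-- sharing an edge agree on which of their perpendicular neighbours lie outside the region: the region
-- is closed under completing unit squares along an edge.  One more bit per edge rules out strips of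
-- width 2, and a 0-coloured side forces the opposite side to be interior, which rules out width 1.
-- Walking along a path in a region closed under square completion fills in the box spanned by its
-- endpoints, so a connected such region is its bounding box.  Conversely, on a rectangle of size at
-- least 3 × 3 the piece at each cell is read off from which of its neighbours lie inside.

+1-1 : ∀ z → z + + 1 - + 1 ≡ z
+1-1 = solve-∀

-1+1 : ∀ z → z - + 1 + + 1 ≡ z
-1+1 = solve-∀

i+[j-i]≡j : ∀ i j → i + (j - i) ≡ j
i+[j-i]≡j = solve-∀

i+j+1≡i+[1+j] : ∀ i j → i + j + + 1 ≡ i + (+ 1 + j)
i+j+1≡i+[1+j] = solve-∀

≤+1 : ∀ x → x ≤ x + + 1
≤+1 x = i≤i+j x (+ 1)

-1≤ : ∀ x → x - + 1 ≤ x
-1≤ x = i-j≤i x (+ 1)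

<⇒+1≤ : ∀ {x y} → x < y → x + + 1 ≤ y
<⇒+1≤ {x} x<y = subst (_≤ _) (+-comm (+ 1) x) (i<j⇒suc[i]≤j x<y)

+1≤⇒< : ∀ {x y} → x + + 1 ≤ y → x < y
+1≤⇒< {x} h = suc[i]≤j⇒i<j (subst (_≤ _) (+-comm x (+ 1)) h)

<⇒≤-1 : ∀ {x y} → x < y → x ≤ y - + 1
<⇒≤-1 {y = y} x<y = subst (_ ≤_) (+-comm (- + 1) y) (i<j⇒i≤pred[j] x<y)

-1< : ∀ x → x - + 1 < x
-1< x = +1≤⇒< (≤-reflexive (-1+1 x))

upward-induction : ∀ (P : ℤ → Set) {a b} → P a → (∀ {y} → a ≤ y → y < b → P y → P (y + + 1)) →
         ∀ {y} → a ≤ y → y ≤ b → P y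
upward-induction P {a} {b} pa next {y} a≤y y≤b =
  subst P a+n≡y (go ∣ y - a ∣ (subst (_≤ b) (sym a+n≡y) y≤b))
  where
  a+n≡y : a + + ∣ y - a ∣ ≡ y
  a+n≡y = trans (cong (λ d → a + d) (0≤i⇒+∣i∣≡i (i≤j⇒0≤j-i a≤y))) (i+[j-i]≡j a y)
  go : ∀ n → a + + n ≤ b → P (a + + n)
  go ℕ.zero    _ = subst P (sym (+-identityʳ a)) pa
  go (ℕ.suc n) h = subst P shift (next (i≤i+j a (+ n)) (+1≤⇒< h') (go n (≤-trans (≤+1 _) h')))
    where
    shift = i+j+1≡i+[1+j] a (+ n)
    h'    = subst (_≤ b) (sym shift) h

downward-induction : ∀ (P : ℤ → Set) {a b} → P a → (∀ {y} → b < y → y ≤ a → P y → P (y - + 1)) →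
           ∀ {y} → b ≤ y → y ≤ a → P y
downward-induction P {a} {b} pa prev {y} b≤y y≤a =
  subst P (neg-involutive y)
    (upward-induction (P ∘ -_) (subst P (sym (neg-involutive a)) pa) next
                      (neg-mono-≤ y≤a) (neg-mono-≤ b≤y))
  where
  next : ∀ {y} → - a ≤ y → y < - b → P (- y) → P (- (y + + 1))
  next {y} -a≤y y<-b = subst P (sym (neg-distrib-+ y (+ 1))) ∘ prev
    (subst (_< - y) (neg-involutive b) (neg-mono-< y<-b))
    (subst (- y ≤_) (neg-involutive a) (neg-mono-≤ -a≤y))

Between : ℤ → ℤ → ℤ → Set
Between a b z = (a ≤ z × z ≤ b) ⊎ (b ≤ z × z ≤ a)

between-left : ∀ a b → Between a b a
between-left a b with ≤-total a b
... | inj₁ a≤b = inj₁ (≤-refl , a≤b)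
... | inj₂ b≤a = inj₂ (b≤a , ≤-refl)

between-right : ∀ a b → Between a b b
between-right a b with ≤-total a b
... | inj₁ a≤b = inj₁ (a≤b , ≤-refl)
... | inj₂ b≤a = inj₂ (≤-refl , b≤a)

between-same : ∀ {a z} → Between a a z → z ≡ a
between-same (inj₁ (a≤z , z≤a)) = ≤-antisym z≤a a≤z
between-same (inj₂ (a≤z , z≤a)) = ≤-antisym z≤a a≤z

between-suc : ∀ {a b z} → Between a b z → z ≡ a ⊎ Between (a + + 1) b z
between-suc {a} {z = z} (inj₁ (a≤z , z≤b)) with z ≟ a
... | yes z≡a = inj₁ z≡a
... | no z≢a  = inj₂ (inj₁ (<⇒+1≤ (≤∧≢⇒< a≤z (z≢a ∘ sym)) , z≤b))
between-suc {a} (inj₂ (b≤z , z≤a)) = inj₂ (inj₂ (b≤z , ≤-trans z≤a (≤+1 a)))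

between-pred : ∀ {a b z} → Between a b z → z ≡ a ⊎ Between (a - + 1) b z
between-pred {a} (inj₁ (a≤z , z≤b)) = inj₂ (inj₁ (≤-trans (-1≤ a) a≤z , z≤b))
between-pred {a} {z = z} (inj₂ (b≤z , z≤a)) with z ≟ a
... | yes z≡a = inj₁ z≡a
... | no z≢a  = inj₂ (inj₂ (b≤z , <⇒≤-1 (≤∧≢⇒< z≤a z≢a)))

between-induction : ∀ (P Q : ℤ → Set) {a b} → P a → (∀ {y} → Between a b y → Q y) →
                    (∀ {y} → P y → Q y → Q (y + + 1) → P (y + + 1)) →
                    (∀ {y} → P y → Q y → Q (y - + 1) → P (y - + 1)) →
                    ∀ {y} → Between a b y → P y
between-induction P Q pa q up down (inj₁ (a≤y , y≤b)) = upward-induction P pa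
  (λ {z} a≤z z<b pz → up pz (q (inj₁ (a≤z , <⇒≤ z<b)))
                               (q (inj₁ (≤-trans a≤z (≤+1 z) , <⇒+1≤ z<b))))
  a≤y y≤b
between-induction P Q pa q up down (inj₂ (b≤y , y≤a)) = downward-induction P pa
  (λ {z} b<z z≤a pz → down pz (q (inj₂ (<⇒≤ b<z , z≤a)))
                                 (q (inj₂ (<⇒≤-1 b<z , ≤-trans (-1≤ z) z≤a))))
  b≤y y≤a

InRange : ℤ → ℤ → ℤ → Set
InRange lo a x = lo ≤ x × x < lo + a

module _ {lo a : ℤ} (a≥3 : + 3 ≤ a) where

  private
    lower-end : ∀ {x} → InRange lo a x → ¬ InRange lo a (x - + 1) → x ≡ lo
    lower-end {x} (lo≤x , x<) out = ≤-antisym x≤lo lo≤x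
      where
      x≤lo = subst (_≤ lo) (-1+1 x) (<⇒+1≤ (≰⇒> (λ lo≤ → out (lo≤ , ≤-<-trans (-1≤ x) x<))))

    upper-end : ∀ {x} → InRange lo a x → ¬ InRange lo a (x + + 1) → x + + 1 ≡ lo + a
    upper-end {x} (lo≤x , x<) out =
      ≤-antisym (<⇒+1≤ x<) (≮⇒≥ (λ x+1< → out (≤-trans lo≤x (≤+1 x) , x+1<)))

    near-bottom : InRange lo a (lo + + 1) × InRange lo a (lo + + 1 + + 1)
    near-bottom = (≤+1 lo , ≤-<-trans (≤+1 _) top<) , (≤-trans (≤+1 lo) (≤+1 _) , top<)
      where top< = subst (_< lo + a) (sym (+-assoc lo (+ 1) (+ 1))) (+-monoʳ-< lo (+1≤⇒< a≥3))

    near-top : InRange lo a (lo + a - + 1 - + 1) × InRange lo a (lo + a - + 1 - + 1 - + 1)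
    near-top = (≤-trans bottom (-1≤ _) , ≤-<-trans (-1≤ _) (-1< _))
             , (bottom , ≤-<-trans (-1≤ _) (≤-<-trans (-1≤ _) (-1< _)))
      where
      eq : ∀ lo a → lo + (a - + 3) ≡ lo + a - + 1 - + 1 - + 1
      eq = solve-∀
      bottom : lo ≤ lo + a - + 1 - + 1 - + 1
      bottom = subst₂ _≤_ (+-identityʳ lo) (eq lo a) (+-monoʳ-≤ lo (i≤j⇒0≤j-i a≥3))

  range-step-up : ∀ {x} → InRange lo a x → ¬ InRange lo a (x - + 1) →
                  InRange lo a (x + + 1) × InRange lo a (x + + 1 + + 1)
  range-step-up x∈ out = subst (λ x → InRange lo a (x + + 1) × InRange lo a (x + + 1 + + 1))
                               (sym (lower-end x∈ out)) near-bottom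

  range-step-down : ∀ {x} → InRange lo a x → ¬ InRange lo a (x + + 1) →
                    InRange lo a (x - + 1) × InRange lo a (x - + 1 - + 1)
  range-step-down {x} x∈ out = subst (λ x → InRange lo a (x - + 1) × InRange lo a (x - + 1 - + 1))
                                     (trans (cong (_- + 1) (sym (upper-end x∈ out))) (+1-1 x)) near-top

i+[j+1-i]≡j+1 : ∀ lo hi → lo + (hi + + 1 - lo) ≡ hi + + 1
i+[j+1-i]≡j+1 = solve-∀

≤⇒<-span : ∀ lo {x hi} → x ≤ hi → x < lo + (hi + + 1 - lo)
≤⇒<-span lo {x} {hi} x≤hi = subst (x <_) (sym (i+[j+1-i]≡j+1 lo hi)) (+1≤⇒< (+-monoˡ-≤ (+ 1) x≤hi))

<-span⇒≤ : ∀ lo {x hi} → x < lo + (hi + + 1 - lo) → x ≤ hi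
<-span⇒≤ lo {x} {hi} x< = subst (x ≤_) (+1-1 hi) (<⇒≤-1 (subst (x <_) (i+[j+1-i]≡j+1 lo hi) x<))

span≥3 : ∀ {lo hi} → lo + + 1 + + 1 ≤ hi → + 3 ≤ hi + + 1 - lo
span≥3 {lo} {hi} h = subst₂ _≤_ (eq₁ lo) (eq₂ lo hi) (+-monoˡ-≤ (+ 1 - lo) h)
  where
  eq₁ : ∀ lo → lo + + 1 + + 1 + (+ 1 - lo) ≡ + 3
  eq₁ = solve-∀
  eq₂ : ∀ lo hi → hi + (+ 1 - lo) ≡ hi + + 1 - lo
  eq₂ = solve-∀

data Side : Set where
  N E S W : Side

neighbour : Side → Cell → Cell
neighbour N = northOf
neighbour E = eastOf
neighbour S = southOf
neighbour W = westOf

colour : ∀ {c} → Side → Piece c → Color c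
colour N = north
colour E = east
colour S = south
colour W = west

opposite : Side → Side
opposite N = S
opposite E = W
opposite S = N
opposite W = E

data Turn : Set where
  left right : Turn

turn : Turn → Side → Side
turn left  N = W
turn right N = E
turn left  E = N
turn right E = S
turn left  S = E
turn right S = W
turn left  W = S
turn right W = N

turn-right-opposite : ∀ s → turn right (opposite s) ≡ turn left s
turn-right-opposite N = refl
turn-right-opposite E = refl
turn-right-opposite S = refl
turn-right-opposite W = refl

turn-left-opposite : ∀ s → turn left (opposite s) ≡ turn right s
turn-left-opposite N = refl
turn-left-opposite E = refl
turn-left-opposite S = refl
turn-left-opposite W = refl

opposite-involutive : ∀ s → opposite (opposite s) ≡ s
opposite-involutive N = refl
opposite-involutive E = refl
opposite-involutive S = refl
opposite-involutive W = refl

neighbour-opposite : ∀ s p → neighbour (opposite s) (neighbour s p) ≡ p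
neighbour-opposite N (x , y) = cong (x ,_) (+1-1 y)
neighbour-opposite E (x , y) = cong (_, y) (+1-1 x)
neighbour-opposite S (x , y) = cong (x ,_) (-1+1 y)
neighbour-opposite W (x , y) = cong (_, y) (-1+1 x)

record LocallyRectangular (R : Region) : Set where
  field
    aligned : ∀ s d {p} → p ∈ R → neighbour s p ∈ R →
              ((neighbour (turn d s) p ∈ R) ⇔ (neighbour (turn d s) (neighbour s p) ∈ R))
    width≥2 : ∀ s {p} → p ∈ R → neighbour s p ∉ R → neighbour (opposite s) p ∈ R
    width≥3 : ∀ s {p} → p ∈ R → neighbour s p ∈ R → neighbour (opposite s) p ∉ R →
              neighbour s (neighbour s p) ∈ R

record Code : Set where
  constructor code
  field
    leftBlank rightBlank farBlank : Bool
open Code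

code-cong : ∀ {l r o l' r' o'} → l ≡ l' → r ≡ r' → o ≡ o' → code l r o ≡ code l' r' o'
code-cong refl refl refl = refl

decode : Fin 8 → Code
decode zero                                     = code false false false
decode (suc zero)                               = code false false true
decode (suc (suc zero))                         = code false true  false
decode (suc (suc (suc zero)))                   = code false true  true
decode (suc (suc (suc (suc zero))))             = code true  false false
decode (suc (suc (suc (suc (suc zero)))))       = code true  false true
decode (suc (suc (suc (suc (suc (suc zero)))))) = code true  true  false
decode (suc (suc (suc (suc (suc (suc (suc zero))))))) = code true  true  true

encode : Code → Fin 8
encode (code false false false) = zero
encode (code false false true)  = suc zero
encode (code false true  false) = suc (suc zero)
encode (code false true  true)  = suc (suc (suc zero))
encode (code true  false false) = suc (suc (suc (suc zero)))
encode (code true  false true)  = suc (suc (suc (suc (suc zero))))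
encode (code true  true  false) = suc (suc (suc (suc (suc (suc zero)))))
encode (code true  true  true)  = suc (suc (suc (suc (suc (suc (suc zero))))))

decode-encode : ∀ c → decode (encode c) ≡ c
decode-encode (code false false false) = refl
decode-encode (code false false true)  = refl
decode-encode (code false true  false) = refl
decode-encode (code false true  true)  = refl
decode-encode (code true  false false) = refl
decode-encode (code true  false true)  = refl
decode-encode (code true  true  false) = refl
decode-encode (code true  true  true)  = refl

isZero : Color 8 → Bool
isZero zero    = true
isZero (pos _) = false
isZero (neg _) = false

blank : Side → Piece 8 → Bool
blank s p = isZero (colour s p)

-- l, r, o: whether the sides to the left and right of the coloured side (facing outwards) and the side
-- opposite it are blank.  A pos colour records these flags of its own piece; the matching neg colour on the
-- neighbouring piece carries the same code, seen with left and right swapped, and the far flag it receives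
-- (the opposite side of the pos piece) must not be blank together with its own opposite side.
Fits : Color 8 → Bool → Bool → Bool → Set
Fits zero    l r o = o ≡ false
Fits (pos i) l r o = let c = decode i in leftBlank c ≡ l × rightBlank c ≡ r × farBlank c ≡ o
Fits (neg i) l r o = let c = decode i in rightBlank c ≡ l × leftBlank c ≡ r × farBlank c ∧ o ≡ false

fits? : ∀ a l r o → Dec (Fits a l r o)
fits? zero    l r o = o Bool.≟ false
fits? (pos i) l r o = let c = decode i in
  (leftBlank c Bool.≟ l) ×-dec (rightBlank c Bool.≟ r) ×-dec (farBlank c Bool.≟ o)
fits? (neg i) l r o = let c = decode i in
  (rightBlank c Bool.≟ l) ×-dec (leftBlank c Bool.≟ r) ×-dec (farBlank c ∧ o Bool.≟ false)

fits-match : ∀ {a a' l r o l' r' o'} → Fits a l r o → Fits a' l' r' o' → Match a a' →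
             l ≡ r' × r ≡ l' × o ∧ o' ≡ false
fits-match (refl , refl , refl) (refl , refl , far) (pos-neg i) = refl , refl , far
fits-match {o = o} (refl , refl , far) (refl , refl , refl) (neg-pos i) =
  refl , refl , trans (Bool.∧-comm o _) far

Consistent : Piece 8 → Set
Consistent p =
  ∀ s → Fits (colour s p) (blank (turn left s) p) (blank (turn right s) p) (blank (opposite s) p)

consistent? : ∀ p → Dec (Consistent p)
consistent? p = map′ (λ (n , e , s , w) → λ { N → n ; E → e ; S → s ; W → w })
                     (λ c → c N , c E , c S , c W)
                     (fits? _ _ _ _ ×-dec fits? _ _ _ _ ×-dec fits? _ _ _ _ ×-dec fits? _ _ _ _)

rot-consistent : ∀ {p} → Consistent p → Consistent (rot p)
rot-consistent c N = c W
rot-consistent c E = c N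
rot-consistent c S = c E
rot-consistent c W = c S

rot^-consistent : ∀ k {p} → Consistent p → Consistent (rot^ k p)
rot^-consistent ℕ.zero    c = c
rot^-consistent (ℕ.suc k) c = rot-consistent (rot^-consistent k c)

colours : List (Color 8)
colours = zero ∷ map pos (allFin 8) ++ map neg (allFin 8)

∈-colours : ∀ a → a ∈ colours
∈-colours zero    = here refl
∈-colours (pos i) = there (∈-++⁺ˡ (∈-map⁺ pos (∈-allFin i)))
∈-colours (neg i) = there (∈-++⁺ʳ (map pos (allFin 8)) (∈-map⁺ neg (∈-allFin i)))

assemble : Color 8 × Color 8 × Color 8 × Color 8 → Piece 8
assemble (n , e , s , w) = piece n e s w

consistentPieces : List (Color 8) → List (Piece 8)
consistentPieces cs =
  filter consistent? (map assemble (cartesianProduct cs (cartesianProduct cs (cartesianProduct cs cs))))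

∈-consistentPieces⁻ : ∀ cs {p} → p ∈ consistentPieces cs → Consistent p
∈-consistentPieces⁻ cs = proj₂ ∘ ∈-filter⁻ consistent?
  {xs = map assemble (cartesianProduct cs (cartesianProduct cs (cartesianProduct cs cs)))}

∈-consistentPieces⁺ : ∀ cs {n e s w} → n ∈ cs → e ∈ cs → s ∈ cs → w ∈ cs →
                      Consistent (piece n e s w) → piece n e s w ∈ consistentPieces cs
∈-consistentPieces⁺ cs n∈ e∈ s∈ w∈ = ∈-filter⁺ consistent?
  (∈-map⁺ assemble (∈-cartesianProduct⁺ n∈ (∈-cartesianProduct⁺ e∈ (∈-cartesianProduct⁺ s∈ w∈))))

true≢false : true ≢ false
true≢false ()

match⇒not-blank : ∀ {a b} → Match a b → isZero a ≡ false
match⇒not-blank (pos-neg i) = refl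
match⇒not-blank (neg-pos i) = refl

module _ {R : Region} {t : Cell → Piece 8} (valid : ValidTiling (consistentPieces colours) R t) where

  private
    edge : ∀ {p} → p ∈ R → ∀ s →
           EdgeOK R (neighbour s p) (colour s (t p)) (colour (opposite s) (t (neighbour s p)))
    edge p∈ N = let (_ , n , _) = valid p∈ in n
    edge p∈ E = let (_ , _ , e , _) = valid p∈ in e
    edge p∈ S = let (_ , _ , _ , s , _) = valid p∈ in s
    edge p∈ W = let (_ , _ , _ , _ , w) = valid p∈ in w

    consistent : ∀ {p} → p ∈ R → Consistent (t p)
    consistent p∈ = let (k , s , s∈ , tp≡) = proj₁ (valid p∈) in
      subst Consistent (sym tp≡) (rot^-consistent k (∈-consistentPieces⁻ colours s∈))

    blank-inside : ∀ s {p} → p ∈ R → neighbour s p ∈ R → blank s (t p) ≡ false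
    blank-inside s p∈ q∈ = match⇒not-blank (proj₁ (edge p∈ s) q∈)

    blank-outside : ∀ s {p} → p ∈ R → neighbour s p ∉ R → blank s (t p) ≡ true
    blank-outside s p∈ q∉ = cong isZero (proj₂ (edge p∈ s) q∉)

    inside-if-not-blank : ∀ s {p} → p ∈ R → blank s (t p) ≡ false → neighbour s p ∈ R
    inside-if-not-blank s {p} p∈ b =
      decidable-stable (neighbour s p ∈? R) λ q∉ → true≢false (trans (sym (blank-outside s p∈ q∉)) b)

    across : ∀ s {p} → p ∈ R → neighbour s p ∈ R →
             let q = neighbour s p in
             blank (turn left s) (t p) ≡ blank (turn right (opposite s)) (t q)
           × blank (turn right s) (t p) ≡ blank (turn left (opposite s)) (t q)
           × blank (opposite s) (t p) ∧ blank (opposite (opposite s)) (t q) ≡ false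
    across s p∈ q∈ = fits-match (consistent p∈ s) (consistent q∈ (opposite s)) (proj₁ (edge p∈ s) q∈)

    blank-agrees : ∀ s d {p} → p ∈ R → neighbour s p ∈ R →
                   blank (turn d s) (t p) ≡ blank (turn d s) (t (neighbour s p))
    blank-agrees s left {p} p∈ q∈ =
      trans (proj₁ (across s p∈ q∈)) (cong (λ s' → blank s' (t (neighbour s p))) (turn-right-opposite s))
    blank-agrees s right {p} p∈ q∈ =
      trans (proj₁ (proj₂ (across s p∈ q∈)))
            (cong (λ s' → blank s' (t (neighbour s p))) (turn-left-opposite s))

    aligned : ∀ s d {p} → p ∈ R → neighbour s p ∈ R →
              ((neighbour (turn d s) p ∈ R) ⇔ (neighbour (turn d s) (neighbour s p) ∈ R))
    aligned s d p∈ q∈ = mk⇔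
      (λ r∈ → inside-if-not-blank (turn d s) q∈
                (trans (sym (blank-agrees s d p∈ q∈)) (blank-inside (turn d s) p∈ r∈)))
      (λ r∈ → inside-if-not-blank (turn d s) p∈
                (trans (blank-agrees s d p∈ q∈) (blank-inside (turn d s) q∈ r∈)))

    width≥2 : ∀ s {p} → p ∈ R → neighbour s p ∉ R → neighbour (opposite s) p ∈ R
    width≥2 s {p} p∈ q∉ = inside-if-not-blank (opposite s) p∈
      (subst (λ a → Fits a (blank (turn left s) (t p)) (blank (turn right s) (t p)) (blank (opposite s) (t p)))
        (proj₂ (edge p∈ s) q∉) (consistent p∈ s))

    width≥3 : ∀ s {p} → p ∈ R → neighbour s p ∈ R → neighbour (opposite s) p ∉ R →
              neighbour s (neighbour s p) ∈ R
    width≥3 s {p} p∈ q∈ o∉ = inside-if-not-blank s q∈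
      (subst (λ s' → blank s' (t q) ≡ false) (opposite-involutive s)
        (subst (λ b → b ∧ blank (opposite (opposite s)) (t q) ≡ false) (blank-outside (opposite s) p∈ o∉)
          (proj₂ (proj₂ (across s p∈ q∈)))))
      where q = neighbour s p

  validTiling⇒locallyRectangular : LocallyRectangular R
  validTiling⇒locallyRectangular = record { aligned = aligned ; width≥2 = width≥2 ; width≥3 = width≥3 }

paint⁺ paint⁻ : Bool → Code → Color 8
paint⁺ b c = if b then zero else pos (encode c)
paint⁻ b c = if b then zero else neg (encode c)

isZero-paint⁺ : ∀ b c → isZero (paint⁺ b c) ≡ b
isZero-paint⁺ true  c = refl
isZero-paint⁺ false c = refl

isZero-paint⁻ : ∀ b c → isZero (paint⁻ b c) ≡ b
isZero-paint⁻ true  c = refl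
isZero-paint⁻ false c = refl

∧-false : ∀ {m o} → (o ≡ true → m ≡ false) → m ∧ o ≡ false
∧-false {m} {true}  h = trans (Bool.∧-identityʳ m) (h refl)
∧-false {m} {false} h = Bool.∧-zeroʳ m

fits-paint⁺ : ∀ {l r o} b → (b ≡ true → o ≡ false) → Fits (paint⁺ b (code l r o)) l r o
fits-paint⁺ true  h = h refl
fits-paint⁺ false h = cong leftBlank d , cong rightBlank d , cong farBlank d
  where d = decode-encode _

fits-paint⁻ : ∀ {l r o m} b → (b ≡ true → o ≡ false) → (b ≡ false → m ∧ o ≡ false) →
              Fits (paint⁻ b (code r l m)) l r o
fits-paint⁻ true  h _ = h refl
fits-paint⁻ {o = o} false _ h =
  cong rightBlank d , cong leftBlank d , subst (λ m → m ∧ o ≡ false) (sym (cong farBlank d)) (h refl)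
  where d = decode-encode _

paint-match⁺ : ∀ {b b' c c'} → b ≡ false → b' ≡ false → c ≡ c' → Match (paint⁺ b c) (paint⁻ b' c')
paint-match⁺ refl refl refl = pos-neg _

paint-match⁻ : ∀ {b b' c c'} → b ≡ false → b' ≡ false → c ≡ c' → Match (paint⁻ b c) (paint⁺ b' c')
paint-match⁻ refl refl refl = neg-pos _

module _ {R : Region} (loc : LocallyRectangular R) where
  open LocallyRectangular loc

  exterior : Side → Cell → Bool
  exterior s p = not (does (neighbour s p ∈? R))

  private
    exterior-∈ : ∀ s {p} → neighbour s p ∈ R → exterior s p ≡ false
    exterior-∈ s {p} q∈ = cong not (dec-true (neighbour s p ∈? R) q∈)

    exterior-∉ : ∀ s {p} → neighbour s p ∉ R → exterior s p ≡ true
    exterior-∉ s {p} q∉ = cong not (dec-false (neighbour s p ∈? R) q∉)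

    exterior⇒∉ : ∀ s {p} → exterior s p ≡ true → neighbour s p ∉ R
    exterior⇒∉ s e q∈ = true≢false (trans (sym e) (exterior-∈ s q∈))

    interior⇒∈ : ∀ s {p} → exterior s p ≡ false → neighbour s p ∈ R
    interior⇒∈ s {p} e =
      decidable-stable (neighbour s p ∈? R) λ q∉ → true≢false (trans (sym (exterior-∉ s q∉)) e)

    exterior-aligned : ∀ s d {p} → p ∈ R → neighbour s p ∈ R →
                       exterior (turn d s) p ≡ exterior (turn d s) (neighbour s p)
    exterior-aligned s d {p} p∈ q∈ = [ inside , outside ]′ (toSum (neighbour (turn d s) p ∈? R))
      where
      open Equivalence (aligned s d p∈ q∈)
      inside = λ a → trans (exterior-∈ (turn d s) a) (sym (exterior-∈ (turn d s) (to a)))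
      outside = λ ¬a → trans (exterior-∉ (turn d s) ¬a) (sym (exterior-∉ (turn d s) (¬a ∘ from)))

  code⁺ code⁻ : Side → Cell → Code
  code⁺ s p = code (exterior (turn left s) p) (exterior (turn right s) p) (exterior (opposite s) p)
  code⁻ s p = code (exterior (turn right s) p) (exterior (turn left s) p) (exterior s (neighbour s p))

  tiling : Cell → Piece 8
  tiling p = piece (paint⁺ (exterior N p) (code⁺ N p)) (paint⁺ (exterior E p) (code⁺ E p))
                   (paint⁻ (exterior S p) (code⁻ S p)) (paint⁻ (exterior W p) (code⁻ W p))

  private
    blank-tiling : ∀ s p → blank s (tiling p) ≡ exterior s p
    blank-tiling N p = isZero-paint⁺ _ _
    blank-tiling E p = isZero-paint⁺ _ _
    blank-tiling S p = isZero-paint⁻ _ _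
    blank-tiling W p = isZero-paint⁻ _ _

    fits⁺ : ∀ s {p} → p ∈ R → Fits (paint⁺ (exterior s p) (code⁺ s p))
                                    (exterior (turn left s) p) (exterior (turn right s) p) (exterior (opposite s) p)
    fits⁺ s p∈ = fits-paint⁺ _ (λ e → exterior-∈ (opposite s) (width≥2 s p∈ (exterior⇒∉ s e)))

    fits⁻ : ∀ s {p} → p ∈ R → Fits (paint⁻ (exterior s p) (code⁻ s p))
                                    (exterior (turn left s) p) (exterior (turn right s) p) (exterior (opposite s) p)
    fits⁻ s p∈ = fits-paint⁻ _ (λ e → exterior-∈ (opposite s) (width≥2 s p∈ (exterior⇒∉ s e)))
      (λ e → ∧-false (λ o → exterior-∈ s (width≥3 s p∈ (interior⇒∈ s e) (exterior⇒∉ (opposite s) o))))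

    tiling-consistent : ∀ {p} → p ∈ R → Consistent (tiling p)
    tiling-consistent {p} p∈ s
      rewrite blank-tiling (turn left s) p | blank-tiling (turn right s) p | blank-tiling (opposite s) p = fits s
      where
      fits : ∀ s → Fits (colour s (tiling p))
                        (exterior (turn left s) p) (exterior (turn right s) p) (exterior (opposite s) p)
      fits N = fits⁺ N p∈
      fits E = fits⁺ E p∈
      fits S = fits⁻ S p∈
      fits W = fits⁻ W p∈

    codes-agree : ∀ s {p q} → p ∈ R → q ∈ R → neighbour s p ≡ q → neighbour (opposite s) q ≡ p →
                  code⁺ s p ≡ code⁻ (opposite s) q
    codes-agree s {p} p∈ q∈ refl back = code-cong
      (trans (exterior-aligned s left p∈ q∈) (cong (λ s' → exterior s' q) (sym (turn-right-opposite s))))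
      (trans (exterior-aligned s right p∈ q∈) (cong (λ s' → exterior s' q) (sym (turn-left-opposite s))))
      (cong (exterior (opposite s)) (sym back))
      where q = neighbour s p

    edge⁺ : ∀ s {p} → p ∈ R →
            let q = neighbour s p in
            EdgeOK R q (paint⁺ (exterior s p) (code⁺ s p))
                       (paint⁻ (exterior (opposite s) q) (code⁻ (opposite s) q))
    edge⁺ s {p} p∈ =
        (λ q∈ → paint-match⁺ (exterior-∈ s q∈) (exterior-∈ (opposite s) back∈) (codes-agree s p∈ q∈ refl back))
      , (λ q∉ → cong (λ b → paint⁺ b (code⁺ s p)) (exterior-∉ s q∉))
      where
      back = neighbour-opposite s p
      back∈ = subst (_∈ R) (sym back) p∈

    edge⁻ : ∀ s {p} → p ∈ R →
            let q = neighbour (opposite s) p in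
            EdgeOK R q (paint⁻ (exterior (opposite s) p) (code⁻ (opposite s) p))
                       (paint⁺ (exterior s q) (code⁺ s q))
    edge⁻ s {p} p∈ =
        (λ q∈ → paint-match⁻ (exterior-∈ (opposite s) q∈) (exterior-∈ s back∈) (sym (codes-agree s q∈ p∈ back refl)))
      , (λ q∉ → cong (λ b → paint⁻ b (code⁻ (opposite s) p)) (exterior-∉ (opposite s) q∉))
      where
      back = subst (λ s' → neighbour s' (neighbour (opposite s) p) ≡ p) (opposite-involutive s)
                   (neighbour-opposite (opposite s) p)
      back∈ = subst (_∈ R) (sym back) p∈

  tiling-valid : ValidTiling (consistentPieces colours) R tiling
  tiling-valid p∈ =
    (0 , tiling _ , ∈-consistentPieces⁺ colours (∈-colours _) (∈-colours _) (∈-colours _) (∈-colours _)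
                                         (tiling-consistent p∈) , refl) ,
    edge⁺ N p∈ , edge⁺ E p∈ , edge⁻ N p∈ , edge⁻ E p∈

Box : Cell → Cell → Cell → Set
Box (px , py) (rx , ry) (zx , zy) = Between px rx zx × Between py ry zy

Minimal Maximal : (Cell → ℤ) → Region → Cell → Set
Minimal f R m = m ∈ R × (∀ {q} → q ∈ R → f m ≤ f q)
Maximal f R m = m ∈ R × (∀ {q} → q ∈ R → f q ≤ f m)

minimal : ∀ (f : Cell → ℤ) {R p} → p ∈ R → ∃[ m ] Minimal f R m
minimal f {R} {p} p∈ = argmin f p R , argmin-all f p∈ (All.tabulate id) , All.lookup (f[argmin]≤f[xs] p R)

maximal : ∀ (f : Cell → ℤ) {R p} → p ∈ R → ∃[ m ] Maximal f R m
maximal f {R} {p} p∈ = argmax f p R , argmax-all f p∈ (All.tabulate id) , All.lookup (f[xs]≤f[argmax] p R)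

module _ {R : Region} (loc : LocallyRectangular R) where
  open LocallyRectangular loc

  private
    complete : ∀ s d {p} → p ∈ R → neighbour s p ∈ R → neighbour (turn d s) (neighbour s p) ∈ R →
               neighbour (turn d s) p ∈ R
    complete s d p∈ q∈ = Equivalence.from (aligned s d p∈ q∈)

  -- Stepping from p to its neighbour q adds one row or column to the box; it is filled in from the
  -- parallel one through q by square completion.
  reach⇒box : ∀ {p r} → Reach R p r → ∀ {z} → Box p r z → z ∈ R
  reach⇒box (here p∈) (bx , by) = subst (_∈ R) (sym (cong₂ _,_ (between-same bx) (between-same by))) p∈
  reach⇒box {px , py} (step p∈ (inj₁ refl) reach) (bx , by) with between-suc by
  ... | inj₂ by' = reach⇒box reach (bx , by')
  ... | inj₁ refl = between-induction (λ x → (x , py) ∈ R) (λ x → (x , py + + 1) ∈ R) p∈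
                      (λ b → reach⇒box reach (b , between-left _ _)) (complete N right) (complete N left) bx
  reach⇒box {px , py} (step p∈ (inj₂ (inj₁ refl)) reach) (bx , by) with between-suc bx
  ... | inj₂ bx' = reach⇒box reach (bx' , by)
  ... | inj₁ refl = between-induction (λ y → (px , y) ∈ R) (λ y → (px + + 1 , y) ∈ R) p∈
                      (λ b → reach⇒box reach (between-left _ _ , b)) (complete E left) (complete E right) by
  reach⇒box {px , py} (step p∈ (inj₂ (inj₂ (inj₁ refl))) reach) (bx , by) with between-pred by
  ... | inj₂ by' = reach⇒box reach (bx , by')
  ... | inj₁ refl = between-induction (λ x → (x , py) ∈ R) (λ x → (x , py - + 1) ∈ R) p∈
                      (λ b → reach⇒box reach (b , between-left _ _)) (complete S left) (complete S right) bx
  reach⇒box {px , py} (step p∈ (inj₂ (inj₂ (inj₂ refl))) reach) (bx , by) with between-pred bx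
  ... | inj₂ bx' = reach⇒box reach (bx' , by)
  ... | inj₁ refl = between-induction (λ y → (px , y) ∈ R) (λ y → (px - + 1 , y) ∈ R) p∈
                      (λ b → reach⇒box reach (between-left _ _ , b)) (complete W right) (complete W left) by

  polyomino⇒rectangle : IsPolyomino R → IsRectangle≥3×3 R
  polyomino⇒rectangle ((p , p∈) , connected) =
    rectangle (minimal proj₁ p∈) (maximal proj₁ p∈) (minimal proj₂ p∈) (maximal proj₂ p∈)
    where
    rectangle : ∃ (Minimal proj₁ R) → ∃ (Maximal proj₁ R) → ∃ (Minimal proj₂ R) → ∃ (Maximal proj₂ R) →
                IsRectangle≥3×3 R
    rectangle (w , w∈ , w≤) (e , e∈ , ≤e) (s , s∈ , s≤) (n , n∈ , ≤n) =
      x₀ , y₀ , a , b , span≥3 (≤e (width≥3 E w∈ (width≥2 W w∈ west∉) west∉)) ,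
      span≥3 (≤n (width≥3 N s∈ (width≥2 S s∈ south∉) south∉)) , mk⇔ bounded fill
      where
      x₀ = proj₁ w
      y₀ = proj₂ s
      a  = proj₁ e + + 1 - x₀
      b  = proj₂ n + + 1 - y₀
      west∉ : neighbour W w ∉ R
      west∉ q∈ = <-irrefl refl (<-≤-trans (-1< x₀) (w≤ q∈))
      south∉ : neighbour S s ∉ R
      south∉ q∈ = <-irrefl refl (<-≤-trans (-1< y₀) (s≤ q∈))
      bounded : ∀ {x y} → (x , y) ∈ R → InRange x₀ a x × InRange y₀ b y
      bounded c∈ = (w≤ c∈ , ≤⇒<-span x₀ (≤e c∈)) , (s≤ c∈ , ≤⇒<-span y₀ (≤n c∈))
      fill : ∀ {x y} → InRange x₀ a x × InRange y₀ b y → (x , y) ∈ R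
      fill ((x₀≤x , x<) , (y₀≤y , y<)) = in-column
        where
        in-row-of-w = reach⇒box (connected w∈ e∈) (inj₁ (x₀≤x , <-span⇒≤ x₀ x<) , between-left _ _)
        in-row-of-s = reach⇒box (connected in-row-of-w s∈) (between-left _ _ , between-right _ _)
        in-column   = reach⇒box (connected in-row-of-s n∈) (between-left _ _ , inj₁ (y₀≤y , <-span⇒≤ y₀ y<))

module _ {R : Region} {x₀ y₀ a b : ℤ} (a≥3 : + 3 ≤ a) (b≥3 : + 3 ≤ b)
         (R≡ : ∀ {x y} → ((x , y) ∈ R) ⇔ (InRange x₀ a x × InRange y₀ b y)) where
  open Equivalence

  private
    swap : ∀ {x y x' y'} → (x , y) ∈ R → (x' , y') ∈ R → (x , y') ∈ R
    swap c d = from R≡ (proj₁ (to R≡ c) , proj₂ (to R≡ d))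

    across-columns : ∀ {x y x' y'} → (x , y) ∈ R → (x' , y) ∈ R → ((x , y') ∈ R ⇔ (x' , y') ∈ R)
    across-columns p∈ q∈ = mk⇔ (swap q∈) (swap p∈)

    across-rows : ∀ {x y x' y'} → (x , y) ∈ R → (x , y') ∈ R → ((x' , y) ∈ R ⇔ (x' , y') ∈ R)
    across-rows p∈ q∈ = mk⇔ (λ r∈ → swap r∈ q∈) (λ r∈ → swap r∈ p∈)

    aligned : ∀ s d {p} → p ∈ R → neighbour s p ∈ R →
              ((neighbour (turn d s) p ∈ R) ⇔ (neighbour (turn d s) (neighbour s p) ∈ R))
    aligned N left  = across-rows
    aligned N right = across-rows
    aligned S left  = across-rows
    aligned S right = across-rows
    aligned E left  = across-columns
    aligned E right = across-columns
    aligned W left  = across-columns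
    aligned W right = across-columns

    column-outside : ∀ {x y} → (x , y) ∉ R → InRange y₀ b y → ¬ InRange x₀ a x
    column-outside c∉ y∈ x∈ = c∉ (from R≡ (x∈ , y∈))

    row-outside : ∀ {x y} → (x , y) ∉ R → InRange x₀ a x → ¬ InRange y₀ b y
    row-outside c∉ x∈ y∈ = c∉ (from R≡ (x∈ , y∈))

    width≥2 : ∀ s {p} → p ∈ R → neighbour s p ∉ R → neighbour (opposite s) p ∈ R
    width≥2 N p∈ q∉ = let (x∈ , y∈) = to R≡ p∈ in
      from R≡ (x∈ , proj₁ (range-step-down b≥3 y∈ (row-outside q∉ x∈)))
    width≥2 S p∈ q∉ = let (x∈ , y∈) = to R≡ p∈ in
      from R≡ (x∈ , proj₁ (range-step-up b≥3 y∈ (row-outside q∉ x∈)))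
    width≥2 E p∈ q∉ = let (x∈ , y∈) = to R≡ p∈ in
      from R≡ (proj₁ (range-step-down a≥3 x∈ (column-outside q∉ y∈)) , y∈)
    width≥2 W p∈ q∉ = let (x∈ , y∈) = to R≡ p∈ in
      from R≡ (proj₁ (range-step-up a≥3 x∈ (column-outside q∉ y∈)) , y∈)

    width≥3 : ∀ s {p} → p ∈ R → neighbour s p ∈ R → neighbour (opposite s) p ∉ R →
              neighbour s (neighbour s p) ∈ R
    width≥3 N p∈ _ o∉ = let (x∈ , y∈) = to R≡ p∈ in
      from R≡ (x∈ , proj₂ (range-step-up b≥3 y∈ (row-outside o∉ x∈)))
    width≥3 S p∈ _ o∉ = let (x∈ , y∈) = to R≡ p∈ in
      from R≡ (x∈ , proj₂ (range-step-down b≥3 y∈ (row-outside o∉ x∈)))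
    width≥3 E p∈ _ o∉ = let (x∈ , y∈) = to R≡ p∈ in
      from R≡ (proj₂ (range-step-up a≥3 x∈ (column-outside o∉ y∈)) , y∈)
    width≥3 W p∈ _ o∉ = let (x∈ , y∈) = to R≡ p∈ in
      from R≡ (proj₂ (range-step-down a≥3 x∈ (column-outside o∉ y∈)) , y∈)

  rectangle⇒locallyRectangular : LocallyRectangular R
  rectangle⇒locallyRectangular = record { aligned = aligned ; width≥2 = width≥2 ; width≥3 = width≥3 }

lemma1 : ∃[ c ] ∃[ S ] ((R : Region) → IsPolyomino R → (Tileable {c} S R ⇔ IsRectangle≥3×3 R))
lemma1 = 8 , consistentPieces colours , λ R polyomino → mk⇔
  (λ (_ , valid) → polyomino⇒rectangle (validTiling⇒locallyRectangular valid) polyomino)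
  (λ (_ , _ , _ , _ , a≥3 , b≥3 , R≡) → let loc = rectangle⇒locallyRectangular a≥3 b≥3 R≡ in
                                        tiling loc , tiling-valid loc)
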